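{- Fix an integer $d\ge 2$. There exists $\tau_d<1$ such that for every $\alpha\in\mathcal S_d$, $$B(\alpha;0,N) = \frac{N}{N_d} + \mathcal O(N^{\tau_d}) \quad (N\to\infty).$$
   Context: The Stern sequence $(s(n))_{n\ge0}$ is defined by $s(0)=0$, $s(1)=1$, $s(2n)=s(n)$, $s(2n+1)=s(n)+s(n+1)$. For an integer $d\ge2$, let $S_d(n)=(s(n)\bmod d,\ s(n+1)\bmod d)$, and let $\mathcal S_d=\{(i\bmod d, j\bmod d): \gcd(i,j,d)=1\}$ (a set of pairs of residue classes mod $d$); $N_d=|\mathcal S_d|$. For $\gamma\in\mathcal S_d$ and integers $U_1<U_2$, let $B(\gamma;U_1,U_2)=|\{m: U_1\le m<U_2,\ S_d(m)=\gamma\}|$. -}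

module Defs where

open import Data.Nat using (ℕ; zero; suc; _+_; _*_; _<_; _≟_; NonZero; ⌊_/2⌋)
open import Data.Nat.DivMod using (_%_)
open import Data.Nat.GCD using (gcd)
open import Data.Bool using (Bool; true; false; _∧_)
open import Relation.Nullary using (yes; no)
open import Relation.Nullary.Decidable using (⌊_⌋)

-- Stern sequence, by fuel-bounded recursion implementing
-- s(0)=0, s(1)=1, s(2n)=s(n), s(2n+1)=s(n)+s(n+1).
-- (fuel f ≥ argument suffices since recursive arguments strictly decrease and stay ≥ 1)
sternAux : ℕ → ℕ → ℕ
sternAux zero _ = 0
sternAux (suc f) zero = 0
sternAux (suc f) (suc zero) = 1
sternAux (suc f) (suc (suc k)) with k % 2 ≟ 0
... | yes _ = sternAux f (suc ⌊ k /2⌋)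
... | no _ = sternAux f (suc ⌊ k /2⌋) + sternAux f (suc (suc ⌊ k /2⌋))

stern : ℕ → ℕ
stern n = sternAux (suc n) n

countBelow : (ℕ → Bool) → ℕ → ℕ
countBelow P zero = 0
countBelow P (suc N) with P N
... | true = suc (countBelow P N)
... | false = countBelow P N

-- B((a,b);0,N) = #{ m : 0 ≤ m < N , s(m) ≡ a, s(m+1) ≡ b (mod d) }
-- (a, b are the canonical representatives in [0,d))
B : (d : ℕ) → .{{_ : NonZero d}} → ℕ → ℕ → ℕ → ℕ
B d a b N = countBelow (λ m → ⌊ stern m % d ≟ a ⌋ ∧ ⌊ stern (suc m) % d ≟ b ⌋) N

-- N_d = |S_d| = #{ (a,b) : 0 ≤ a,b < d, gcd(a,b,d) = 1 }
Nd : ℕ → ℕ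
Nd d = go d
  where
  go : ℕ → ℕ
  go zero = 0
  go (suc a) = countBelow (λ b → ⌊ gcd (gcd a b) d ≟ 1 ⌋) d + go a

-- Write S m = (s(m), s(m+1)) mod d.  Stern's recurrences give S(2m) = L(S m) and S(2m+1) = R(S m)
-- for L(a,b) = (a, a+b) and R(a,b) = (a+b, b), so summing an observable h along S over [0, 2ⁿM)
-- is the same as summing Pⁿh over [0, M), where P h = h ∘ L + h ∘ R.  L and R permute the
-- primitive classes, hence P doubles the total of h over them.  A subtractive Euclidean algorithm,
-- run twice, leads every primitive class to (0,1) by a word in L and R of length exactly K (pad
-- with L, which fixes (0,1)).  As Pᴷh(z) sums h over the endpoints of all Q = 2ᴷ such words, one of
-- which is (0,1), Pᴷ multiplies totals by Q but the oscillation of h by at most ρ = Q - 1.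
-- Expanding N in base Q, the indicator of α then gives N_d·B(α;0,N) - N = O(ρˡ) for
-- Qˡ ≤ N < Qˡ⁺¹, i.e. O(N^τ) with τ = log ρ / log Q; Bernoulli's inequality ρ^(ρ²+1) ≤ Q^(ρ²)
-- turns this into the rational exponent ρ²/(ρ²+1).

module Submission where

open import Defs
open import Data.Bool using (Bool; true; false; not; _∧_; if_then_else_)
open import Data.List using (List; []; _∷_; _++_; replicate; length)
open import Data.List.Properties using (length-++; length-replicate)
open import Data.Nat
open import Data.Nat.DivMod
open import Data.Nat.Divisibility
open import Data.Nat.GCD
open import Data.Nat.Induction using (<-rec)
open import Data.Nat.Properties
open import Data.Nat.Tactic.RingSolver using (solve-∀)
open import Algebra.Properties.CommutativeSemigroup +-commutativeSemigroup
  using (interchange; xy∙z≈xz∙y)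
open import Data.Product
open import Data.Sum using (_⊎_; inj₁; inj₂)
open import Relation.Binary.PropositionalEquality
open import Relation.Nullary using (yes; no; contradiction)
open import Relation.Nullary.Decidable using (⌊_⌋)

private variable
  f g : ℕ → ℕ
  c x y : ℕ

-- Finite sums

∑ : (ℕ → ℕ) → ℕ → ℕ
∑ f zero    = 0
∑ f (suc n) = ∑ f n + f n

syntax ∑ (λ i → e) n = ∑[ i < n ] e

∑-cong : ∀ n → (∀ i → i < n → f i ≡ g i) → ∑ f n ≡ ∑ g n
∑-cong zero    _   = refl
∑-cong (suc n) f≡g = cong₂ _+_ (∑-cong n (λ i i<n → f≡g i (m<n⇒m<1+n i<n))) (f≡g n ≤-refl)

∑-mono-≤ : ∀ n → (∀ i → i < n → f i ≤ g i) → ∑ f n ≤ ∑ g n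
∑-mono-≤ zero    _   = z≤n
∑-mono-≤ (suc n) f≤g = +-mono-≤ (∑-mono-≤ n (λ i i<n → f≤g i (m<n⇒m<1+n i<n))) (f≤g n ≤-refl)

∑-distrib-+ : ∀ n → ∑[ i < n ] (f i + g i) ≡ ∑ f n + ∑ g n
∑-distrib-+         zero    = refl
∑-distrib-+ {f} {g} (suc n) =
  trans (cong (_+ (f n + g n)) (∑-distrib-+ n)) (interchange (∑ f n) (∑ g n) (f n) (g n))

∑-distribˡ-* : ∀ c n → ∑[ i < n ] (c * f i) ≡ c * ∑ f n
∑-distribˡ-*     c zero    = sym (*-zeroʳ c)
∑-distribˡ-* {f} c (suc n) =
  trans (cong (_+ c * f n) (∑-distribˡ-* c n)) (sym (*-distribˡ-+ c (∑ f n) (f n)))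

∑-const : ∀ c n → ∑[ i < n ] c ≡ n * c
∑-const c zero    = refl
∑-const c (suc n) = trans (cong (_+ c) (∑-const c n)) (+-comm (n * c) c)

∑-zero : ∀ n → (∀ i → i < n → f i ≡ 0) → ∑ f n ≡ 0
∑-zero n f≡0 = trans (∑-cong n f≡0) (trans (∑-const 0 n) (*-zeroʳ n))

∑-comm : ∀ (h : ℕ → ℕ → ℕ) m n → ∑[ i < m ] ∑[ j < n ] h i j ≡ ∑[ j < n ] ∑[ i < m ] h i j
∑-comm h zero    n = sym (∑-zero n (λ _ _ → refl))
∑-comm h (suc m) n =
  trans (cong (_+ ∑[ j < n ] h m j) (∑-comm h m n)) (sym (∑-distrib-+ n))

∑-split : ∀ m n → ∑ f (m + n) ≡ ∑ f m + ∑[ i < n ] f (m + i)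
∑-split {f} m zero    = trans (cong (∑ f) (+-identityʳ m)) (sym (+-identityʳ (∑ f m)))
∑-split {f} m (suc n) = begin
  ∑ f (m + suc n)                             ≡⟨ cong (∑ f) (+-suc m n) ⟩
  ∑ f (m + n) + f (m + n)                     ≡⟨ cong (_+ f (m + n)) (∑-split m n) ⟩
  ∑ f m + ∑[ i < n ] f (m + i) + f (m + n)    ≡⟨ +-assoc (∑ f m) _ _ ⟩
  ∑ f m + ∑[ i < suc n ] f (m + i)            ∎
  where open ≡-Reasoning

∑-pairs : ∀ n → ∑ f (n + n) ≡ ∑[ i < n ] (f (i + i) + f (suc (i + i)))
∑-pairs         zero    = refl
∑-pairs {f} (suc n) = begin
  ∑ f (suc n + suc n)                        ≡⟨ cong (λ k → ∑ f (suc k)) (+-suc n n) ⟩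
  ∑ f (n + n) + f (n + n) + f (suc (n + n))  ≡⟨ +-assoc (∑ f (n + n)) _ _ ⟩
  ∑ f (n + n) + pair n                       ≡⟨ cong (_+ pair n) (∑-pairs n) ⟩
  ∑[ i < suc n ] pair i                      ∎
  where
  open ≡-Reasoning
  pair : ℕ → ℕ
  pair i = f (i + i) + f (suc (i + i))

∑-pointed : ∀ a n → a < n → (∀ i → i < n → i ≢ a → f i ≡ 0) → ∑ f n ≡ f a
∑-pointed {f} a (suc n) a<1+n others with m≤n⇒m<n∨m≡n (m<1+n⇒m≤n a<1+n)
... | inj₁ a<n  = trans (cong₂ _+_ (∑-pointed a n a<n (λ i i<n → others i (m<n⇒m<1+n i<n)))
                                   (others n ≤-refl (λ n≡a → <-irrefl (sym n≡a) a<n)))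
                        (+-identityʳ (f a))
... | inj₂ refl = cong (_+ f a) (∑-zero a (λ i i<a → others i (m<n⇒m<1+n i<a) (<⇒≢ i<a)))

∑-shift : ∀ n → f n ≡ f 0 → ∑[ i < n ] f (suc i) ≡ ∑ f n
∑-shift     zero    _        = refl
∑-shift {f} (suc n) periodic = begin
  ∑[ i < n ] f (suc i) + f (suc n)  ≡⟨ cong (∑[ i < n ] f (suc i) +_) periodic ⟩
  ∑[ i < n ] f (suc i) + f 0        ≡⟨ +-comm _ (f 0) ⟩
  f 0 + ∑[ i < n ] f (suc i)        ≡⟨ sym (∑-split 1 n) ⟩
  ∑ f (suc n)                       ∎
  where open ≡-Reasoning

∑-rotate : ∀ n .{{_ : NonZero n}} (f : ℕ → ℕ) k → ∑[ i < n ] f ((k + i) % n) ≡ ∑ f n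
∑-rotate n f zero    = ∑-cong n (λ i i<n → cong f (m<n⇒m%n≡m i<n))
∑-rotate n f (suc k) = begin
  ∑[ i < n ] f ((suc k + i) % n)  ≡⟨ ∑-cong n (λ i _ → cong (λ j → f (j % n)) (sym (+-suc k i))) ⟩
  ∑[ i < n ] f ((k + suc i) % n)  ≡⟨ ∑-shift n (cong f wraps) ⟩
  ∑[ i < n ] f ((k + i) % n)      ≡⟨ ∑-rotate n f k ⟩
  ∑ f n                           ∎
  where
  open ≡-Reasoning
  wraps : (k + n) % n ≡ (k + 0) % n
  wraps = trans ([m+n]%n≡m%n k n) (cong (_% n) (sym (+-identityʳ k)))

-- Stern's recurrences

private
  half< : ∀ {k h} → suc k < h → suc ⌊ k /2⌋ < h
  half< {k} = ≤-trans (s≤s (s≤s (⌊n/2⌋≤n k)))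

  half+1< : ∀ {k h} → k % 2 ≢ 0 → suc k < h → suc (suc ⌊ k /2⌋) < h
  half+1< {zero}  k-odd = contradiction refl k-odd
  half+1< {suc k} _     = ≤-trans (s≤s (s≤s (⌊n/2⌋<n k)))

sternAux-fuel : ∀ {u v} n → n < u → n < v → sternAux u n ≡ sternAux v n
sternAux-fuel {suc u} {suc v} zero          _         _         = refl
sternAux-fuel {suc u} {suc v} (suc zero)    _         _         = refl
sternAux-fuel {suc u} {suc v} (suc (suc k)) (s≤s k<u) (s≤s k<v) with k % 2 ≟ 0
... | yes _   = sternAux-fuel _ (half< k<u) (half< k<v)
... | no  odd = cong₂ _+_ (sternAux-fuel _ (half< k<u) (half< k<v))
                          (sternAux-fuel _ (half+1< odd k<u) (half+1< odd k<v))

sternAux-stable : ∀ {u} n → n < u → sternAux u n ≡ stern n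
sternAux-stable n n<u = sternAux-fuel n n<u ≤-refl

⌊1+n+n/2⌋≡n : ∀ n → ⌊ suc (n + n) /2⌋ ≡ n
⌊1+n+n/2⌋≡n zero    = refl
⌊1+n+n/2⌋≡n (suc n) rewrite +-suc n n = cong suc (⌊1+n+n/2⌋≡n n)

[n+n]%2≡0 : ∀ n → (n + n) % 2 ≡ 0
[n+n]%2≡0 n = trans (cong (_% 2) (n+n≡n*2 n)) (m*n%n≡0 n 2)
  where
  n+n≡n*2 : ∀ n → n + n ≡ n * 2
  n+n≡n*2 = solve-∀

[1+n+n]%2≡1 : ∀ n → suc (n + n) % 2 ≡ 1
[1+n+n]%2≡1 n = trans (%-distribˡ-+ 1 (n + n) 2) (cong (λ r → (1 + r) % 2) ([n+n]%2≡0 n))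

stern-even : ∀ n → stern (n + n) ≡ stern n
stern-even zero    = refl
stern-even (suc n) rewrite +-suc n n with (n + n) % 2 ≟ 0
... | yes _   = trans (cong (λ j → sternAux (2 + (n + n)) (suc j)) (sym (n≡⌊n+n/2⌋ n)))
                      (sternAux-stable (suc n) (s≤s (s≤s (m≤m+n n n))))
... | no  odd = contradiction ([n+n]%2≡0 n) odd

stern-odd : ∀ n → stern (suc (n + n)) ≡ stern n + stern (suc n)
stern-odd zero    = refl
stern-odd (suc n) rewrite +-suc n n with suc (n + n) % 2 ≟ 0
... | yes even = contradiction (trans (sym ([1+n+n]%2≡1 n)) even) λ ()
... | no  _    = cong₂ _+_
  (trans (cong (λ j → sternAux (3 + (n + n)) (suc j)) (⌊1+n+n/2⌋≡n n))
         (sternAux-stable (suc n) (s≤s (s≤s (m≤n⇒m≤1+n (m≤m+n n n))))))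
  (trans (cong (λ j → sternAux (3 + (n + n)) (2 + j)) (⌊1+n+n/2⌋≡n n))
         (sternAux-stable (suc (suc n)) (s≤s (s≤s (s≤s (m≤m+n n n))))))

-- Arithmetic estimates

m+n≤1+o⇒n≤o : ∀ {m n o} → 0 < m → m + n ≤ suc o → n ≤ o
m+n≤1+o⇒n≤o {n = n} 0<m m+n≤1+o = m<1+n⇒m≤n (<-≤-trans (m<n+m n 0<m) m+n≤1+o)

[2*m]*n≡m*n+m*n : ∀ m n → 2 * m * n ≡ m * n + m * n
[2*m]*n≡m*n+m*n = solve-∀

^-distribʳ-* : ∀ m n o → (m * n) ^ o ≡ m ^ o * n ^ o
^-distribʳ-* m n zero    = refl
^-distribʳ-* m n (suc o) =
  trans (cong (m * n *_) (^-distribʳ-* m n o)) ([m*n]*[o*p]≡[m*o]*[n*p] m n (m ^ o) (n ^ o))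

bernoulli : ∀ a k → a ^ k * (a + k) ≤ suc a ^ k * a
bernoulli a zero    = ≤-reflexive (+-identityʳ (a + 0))
bernoulli a (suc k) = begin
  a ^ suc k * (a + suc k)     ≡⟨ rearrange a (a ^ k) (a + suc k) ⟩
  a ^ k * (a * (a + suc k))   ≤⟨ *-monoʳ-≤ (a ^ k) step ⟩
  a ^ k * (suc a * (a + k))   ≡⟨ exchange (a ^ k) (suc a) (a + k) ⟩
  suc a * (a ^ k * (a + k))   ≤⟨ *-monoʳ-≤ (suc a) (bernoulli a k) ⟩
  suc a * (suc a ^ k * a)     ≡⟨ *-assoc (suc a) (suc a ^ k) a ⟨
  suc a ^ suc k * a           ∎
  where
  open ≤-Reasoning
  rearrange : ∀ x y z → x * y * z ≡ y * (x * z)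
  rearrange = solve-∀
  exchange : ∀ x y z → x * (y * z) ≡ y * (x * z)
  exchange = solve-∀
  expand : ∀ a k → a * (a + suc k) ≡ a + a * (a + k)
  expand = solve-∀
  step : a * (a + suc k) ≤ suc a * (a + k)
  step = ≤-trans (≤-reflexive (expand a k)) (+-monoˡ-≤ (a * (a + k)) (m≤m+n a k))

m^[1+m*m]≤[1+m]^[m*m] : ∀ a → a ^ suc (a * a) ≤ suc a ^ (a * a)
m^[1+m*m]≤[1+m]^[m*m] zero       = z≤n
m^[1+m*m]≤[1+m]^[m*m] a@(suc _) = *-cancelʳ-≤ _ _ a (begin
  a ^ suc (a * a) * a        ≡⟨ rearrange a (a ^ (a * a)) ⟩
  a ^ (a * a) * (a * a)      ≤⟨ *-monoʳ-≤ (a ^ (a * a)) (m≤n+m (a * a) a) ⟩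
  a ^ (a * a) * (a + a * a)  ≤⟨ bernoulli a (a * a) ⟩
  suc a ^ (a * a) * a        ∎)
  where
  open ≤-Reasoning
  rearrange : ∀ a p → a * p * a ≡ p * (a * a)
  rearrange = solve-∀

log-bracket : ∀ {b} → 1 < b → ∀ n → Σ[ l ∈ ℕ ] b ^ l ≤ suc n × suc n < b ^ suc l
log-bracket {b} 1<b zero    = 0 , ≤-refl , subst (1 <_) (sym (*-identityʳ b)) 1<b
log-bracket {b} 1<b (suc n) with log-bracket 1<b n
... | l , lower , upper with suc (suc n) <? b ^ suc l
...   | yes below = l , m≤n⇒m≤1+n lower , below
...   | no  ¬below = suc l , ≤-reflexive (sym reached) ,
                     subst (_< b ^ suc (suc l)) (sym reached) (^-monoʳ-< b 1<b (n<1+n (suc l)))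
  where
  reached : suc (suc n) ≡ b ^ suc l
  reached = ≤-antisym upper (≮⇒≥ ¬below)

geom : ℕ → ℕ → ℕ
geom r zero    = 0
geom r (suc l) = 1 + r * geom r l

geom<^ : ∀ {r} → 2 ≤ r → ∀ l → geom r l < r ^ l
geom<^     _   zero    = s≤s z≤n
geom<^ {r} 2≤r (suc l) = begin
  2 + r * geom r l    ≤⟨ +-monoˡ-≤ (r * geom r l) 2≤r ⟩
  r + r * geom r l    ≡⟨ *-suc r (geom r l) ⟨
  r * suc (geom r l)  ≤⟨ *-monoʳ-≤ r (geom<^ 2≤r l) ⟩
  r * r ^ l           ∎
  where open ≤-Reasoning

[m^n]^o≡[m^o]^n : ∀ m n o → (m ^ n) ^ o ≡ (m ^ o) ^ n
[m^n]^o≡[m^o]^n m n o =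
  trans (^-*-assoc m n o) (trans (cong (m ^_) (*-comm n o)) (sym (^-*-assoc m o n)))

geometric⇒power : ∀ {A r b p q l N} → r ^ q ≤ b ^ p → b ^ l ≤ N →
                  (A * r ^ suc l) ^ q ≤ A ^ q * b ^ p * N ^ p
geometric⇒power {A} {r} {b} {p} {q} {l} {N} r^q≤b^p b^l≤N = begin
  (A * r ^ suc l) ^ q            ≡⟨ ^-distribʳ-* A (r ^ suc l) q ⟩
  A ^ q * (r ^ suc l) ^ q        ≡⟨ cong (A ^ q *_) ([m^n]^o≡[m^o]^n r (suc l) q) ⟩
  A ^ q * (r ^ q) ^ suc l        ≤⟨ *-monoʳ-≤ (A ^ q) (^-monoˡ-≤ (suc l) r^q≤b^p) ⟩
  A ^ q * (b ^ p * (b ^ p) ^ l)  ≡⟨ cong (λ t → A ^ q * (b ^ p * t)) ([m^n]^o≡[m^o]^n b p l) ⟩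
  A ^ q * (b ^ p * (b ^ l) ^ p)  ≤⟨ *-monoʳ-≤ (A ^ q) (*-monoʳ-≤ (b ^ p) (^-monoˡ-≤ p b^l≤N)) ⟩
  A ^ q * (b ^ p * N ^ p)        ≡⟨ *-assoc (A ^ q) (b ^ p) (N ^ p) ⟨
  A ^ q * b ^ p * N ^ p          ∎
  where open ≤-Reasoning

infix 4 _≈[_]_

_≈[_]_ : ℕ → ℕ → ℕ → Set
x ≈[ e ] y = x ≤ y + e × y ≤ x + e

module _ {e : ℕ} where

  ≈-reflexive : x ≡ y → x ≈[ e ] y
  ≈-reflexive {x} {y} refl = m≤m+n x e , m≤m+n x e

  ≈-weaken : ∀ {e′} → e ≤ e′ → x ≈[ e ] y → x ≈[ e′ ] y
  ≈-weaken {x} {y} e≤e′ (x≤ , y≤) = ≤-trans x≤ (+-monoʳ-≤ y e≤e′) , ≤-trans y≤ (+-monoʳ-≤ x e≤e′)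

  ≈-interval : c ≤ x → x ≤ c + e → c ≤ y → y ≤ c + e → x ≈[ e ] y
  ≈-interval c≤x x≤ c≤y y≤ = ≤-trans x≤ (+-monoˡ-≤ e c≤y) , ≤-trans y≤ (+-monoˡ-≤ e c≤x)

  ≈⇒∣-∣≤ : x ≈[ e ] y → ∣ x - y ∣ ≤ e
  ≈⇒∣-∣≤ {x} {y} (x≤ , y≤) with ≤-total x y
  ... | inj₁ x≤y = subst (_≤ e) (sym (m≤n⇒∣m-n∣≡n∸m x≤y)) (m≤n+o⇒m∸n≤o y x y≤)
  ... | inj₂ y≤x = subst (_≤ e) (sym (m≤n⇒∣n-m∣≡n∸m y≤x)) (m≤n+o⇒m∸n≤o x y x≤)

≈-+ : ∀ {x x′ y y′ e e′} → x ≈[ e ] y → x′ ≈[ e′ ] y′ → x + x′ ≈[ e + e′ ] y + y′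
≈-+ {x} {x′} {y} {y′} {e} {e′} (x≤ , y≤) (x′≤ , y′≤) =
  subst (x + x′ ≤_) (interchange y e y′ e′) (+-mono-≤ x≤ x′≤) ,
  subst (y + y′ ≤_) (interchange x e x′ e′) (+-mono-≤ y≤ y′≤)

≈-∑ : ∀ {e} n → (∀ i → i < n → f i ≈[ e ] g i) → ∑ f n ≈[ n * e ] ∑ g n
≈-∑         zero    _     = z≤n , z≤n
≈-∑ {f} {g} {e} (suc n) f≈g =
  subst (∑ f (suc n) ≈[_] ∑ g (suc n)) (+-comm (n * e) e)
        (≈-+ (≈-∑ n (λ i i<n → f≈g i (m<n⇒m<1+n i<n))) (f≈g n ≤-refl))

-- Common divisors

∣gcd⇒∣×∣ : ∀ {c} m n → c ∣ gcd m n → c ∣ m × c ∣ n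
∣gcd⇒∣×∣ m n c∣gcd = ∣-trans c∣gcd (gcd[m,n]∣m m n) , ∣-trans c∣gcd (gcd[m,n]∣n m n)

gcd-cong-∣ : ∀ m n m′ n′ → (∀ {c} → c ∣ m × c ∣ n → c ∣ m′ × c ∣ n′) →
             (∀ {c} → c ∣ m′ × c ∣ n′ → c ∣ m × c ∣ n) → gcd m n ≡ gcd m′ n′
gcd-cong-∣ m n m′ n′ to from = gcd-universality
  (λ c∣m′n′ → uncurry gcd-greatest (from c∣m′n′))
  (λ c∣gcd → to (∣gcd⇒∣×∣ m n c∣gcd))

gcd-gcd-cong-∣ : ∀ m n m′ n′ e → (∀ {c} → c ∣ e → c ∣ m × c ∣ n → c ∣ m′ × c ∣ n′) →
                 (∀ {c} → c ∣ e → c ∣ m′ × c ∣ n′ → c ∣ m × c ∣ n) →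
                 gcd (gcd m n) e ≡ gcd (gcd m′ n′) e
gcd-gcd-cong-∣ m n m′ n′ e to from = gcd-cong-∣ (gcd m n) e (gcd m′ n′) e
  (λ (c∣gcd , c∣e) → uncurry gcd-greatest (to c∣e (∣gcd⇒∣×∣ m n c∣gcd)) , c∣e)
  (λ (c∣gcd , c∣e) → uncurry gcd-greatest (from c∣e (∣gcd⇒∣×∣ m′ n′ c∣gcd)) , c∣e)

gcd[m,m+n]≡gcd[m,n] : ∀ m n → gcd m (m + n) ≡ gcd m n
gcd[m,m+n]≡gcd[m,n] m n = gcd-cong-∣ m (m + n) m n
  (λ (c∣m , c∣m+n) → c∣m , ∣m+n∣m⇒∣n c∣m+n c∣m)
  (λ (c∣m , c∣n) → c∣m , ∣m∣n⇒∣m+n c∣m c∣n)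

gcd[m+n,m]≡gcd[n,m] : ∀ m n → gcd (m + n) m ≡ gcd n m
gcd[m+n,m]≡gcd[n,m] m n =
  trans (gcd-comm (m + n) m) (trans (gcd[m,m+n]≡gcd[m,n] m n) (gcd-comm m n))

gcd[n,m%n]≡gcd[m,n] : ∀ m n .{{_ : NonZero n}} → gcd n (m % n) ≡ gcd m n
gcd[n,m%n]≡gcd[m,n] m n = gcd-cong-∣ n (m % n) m n
  (λ (c∣n , c∣m%n) → ∣n∣m%n⇒∣m c∣n c∣m%n , c∣n)
  (λ (c∣m , c∣n) → c∣n , %-presˡ-∣ c∣m c∣n)

∣m∣n⇒∣[m+n]%o : ∀ {c m n o} .{{_ : NonZero o}} → c ∣ o → c ∣ m → c ∣ n → c ∣ (m + n) % o
∣m∣n⇒∣[m+n]%o c∣o c∣m c∣n = %-presˡ-∣ (∣m∣n⇒∣m+n c∣m c∣n) c∣o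

∣[m+n]%o∣m⇒∣n : ∀ {c m n o} .{{_ : NonZero o}} → c ∣ o → c ∣ (m + n) % o → c ∣ m → c ∣ n
∣[m+n]%o∣m⇒∣n c∣o c∣m+n c∣m = ∣m+n∣m⇒∣n (∣n∣m%n⇒∣m c∣o c∣m+n) c∣m

∣[m+n]%o∣n⇒∣m : ∀ {c m n o} .{{_ : NonZero o}} → c ∣ o → c ∣ (m + n) % o → c ∣ n → c ∣ m
∣[m+n]%o∣n⇒∣m {c} {m} {n} c∣o c∣m+n c∣n =
  ∣m+n∣m⇒∣n (subst (c ∣_) (+-comm m n) (∣n∣m%n⇒∣m c∣o c∣m+n)) c∣n

-- Binary induction and counting

halve : ∀ n → ∃[ m ] (n ≡ m + m ⊎ n ≡ suc (m + m))
halve zero    = 0 , inj₁ refl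
halve (suc n) with halve n
... | m , inj₁ refl = m , inj₂ refl
... | m , inj₂ refl = suc m , inj₁ (cong suc (sym (+-suc m m)))

binary-induction : ∀ {ℓ} (P : ℕ → Set ℓ) → P 0 → (∀ m → P m → P (m + m)) →
                   (∀ m → P m → P (suc (m + m))) → ∀ n → P n
binary-induction P P0 even odd = <-rec P step
  where
  step : ∀ n → (∀ {m} → m < n → P m) → P n
  step n rec with halve n
  ... | zero  , inj₁ refl = P0
  ... | suc m , inj₁ refl = even (suc m) (rec (m<m+n (suc m) z<s))
  ... | m     , inj₂ refl = odd m (rec (s≤s (m≤m+n m m)))

countBelow-∑ : ∀ P N → countBelow P N ≡ ∑[ i < N ] (if P i then 1 else 0)
countBelow-∑ P zero    = refl
countBelow-∑ P (suc N) with P N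
... | true  = trans (cong suc (countBelow-∑ P N)) (+-comm 1 _)
... | false = trans (countBelow-∑ P N) (sym (+-identityʳ _))

private
  -- `Nd` sums its rows through a `where`-bound helper; unification solves the metavariable
  -- `Nd-rows` to that helper, which makes it available for induction.
  mutual
    Nd-rows : ℕ → ℕ → ℕ
    Nd-rows = _

    Nd-suc : ∀ k → Nd (suc k) ≡
             countBelow (λ b → ⌊ gcd (gcd k b) (suc k) ≟ 1 ⌋) (suc k) + Nd-rows (suc k) k
    Nd-suc k with suc k
    ... | D = refl

  Nd-rows-∑ : ∀ D a → Nd-rows D a ≡ ∑[ i < a ] countBelow (λ b → ⌊ gcd (gcd i b) D ≟ 1 ⌋) D
  Nd-rows-∑ D zero    = refl
  Nd-rows-∑ D (suc a) = trans (cong (row a +_) (Nd-rows-∑ D a)) (+-comm (row a) _)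
    where
    row : ℕ → ℕ
    row i = countBelow (λ b → ⌊ gcd (gcd i b) D ≟ 1 ⌋) D

Nd-∑ : ∀ D → Nd D ≡ ∑[ a < D ] countBelow (λ b → ⌊ gcd (gcd a b) D ≟ 1 ⌋) D
Nd-∑ zero    = refl
Nd-∑ (suc k) = trans (Nd-suc k) (trans (cong (row k +_) (Nd-rows-∑ (suc k) k)) (+-comm (row k) _))
  where
  row : ℕ → ℕ
  row i = countBelow (λ b → ⌊ gcd (gcd i b) (suc k) ≟ 1 ⌋) (suc k)

module Residues (d : ℕ) .{{_ : NonZero d}} (2≤d : 2 ≤ d) where

  State : Set
  State = ℕ × ℕ

  L R : State → State
  L (a , b) = (a , (a + b) % d)
  R (a , b) = ((a + b) % d , b)

  move : Bool → State → State
  move true  = L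
  move false = R

  run : List Bool → State → State
  run []      z = z
  run (b ∷ w) z = run w (move b z)

  run-++ : ∀ u w z → run (u ++ w) z ≡ run w (run u z)
  run-++ []      w z = refl
  run-++ (b ∷ u) w z = run-++ u w (move b z)

  S : ℕ → State
  S m = (stern m % d , stern (suc m) % d)

  S-even : ∀ m → S (m + m) ≡ L (S m)
  S-even m = cong₂ _,_
    (cong (_% d) (stern-even m))
    (trans (cong (_% d) (stern-odd m)) (%-distribˡ-+ (stern m) (stern (suc m)) d))

  S-odd : ∀ m → S (suc (m + m)) ≡ R (S m)
  S-odd m = cong₂ _,_
    (trans (cong (_% d) (stern-odd m)) (%-distribˡ-+ (stern m) (stern (suc m)) d))
    (cong (_% d) (trans (cong stern (sym (+-suc (suc m) m))) (stern-even (suc m))))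

  z₀ : State
  z₀ = (0 , 1)

  0%d≡0 : 0 % d ≡ 0
  0%d≡0 = m<n⇒m%n≡m (≤-trans (s≤s z≤n) 2≤d)

  1%d≡1 : 1 % d ≡ 1
  1%d≡1 = m<n⇒m%n≡m 2≤d

  S-zero : S 0 ≡ z₀
  S-zero = cong₂ _,_ 0%d≡0 1%d≡1

  L-z₀ : L z₀ ≡ z₀
  L-z₀ = cong (0 ,_) 1%d≡1

  Primitive : State → Set
  Primitive (a , b) = a < d × b < d × gcd (gcd a b) d ≡ 1

  z₀-primitive : Primitive z₀
  z₀-primitive = ≤-trans (s≤s z≤n) 2≤d , 2≤d , gcd-zeroˡ d

  gcd-L : ∀ a b → gcd (gcd a ((a + b) % d)) d ≡ gcd (gcd a b) d
  gcd-L a b = gcd-gcd-cong-∣ a ((a + b) % d) a b d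
    (λ c∣d (c∣a , c∣a+b) → c∣a , ∣[m+n]%o∣m⇒∣n c∣d c∣a+b c∣a)
    (λ c∣d (c∣a , c∣b) → c∣a , ∣m∣n⇒∣[m+n]%o c∣d c∣a c∣b)

  gcd-R : ∀ a b → gcd (gcd ((a + b) % d) b) d ≡ gcd (gcd a b) d
  gcd-R a b = gcd-gcd-cong-∣ ((a + b) % d) b a b d
    (λ c∣d (c∣a+b , c∣b) → ∣[m+n]%o∣n⇒∣m c∣d c∣a+b c∣b , c∣b)
    (λ c∣d (c∣a , c∣b) → ∣m∣n⇒∣[m+n]%o c∣d c∣a c∣b , c∣b)

  move-primitive : ∀ b {z} → Primitive z → Primitive (move b z)
  move-primitive true  {a , b} (a<d , b<d , coprime) = a<d , m%n<n (a + b) d , trans (gcd-L a b) coprime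
  move-primitive false {a , b} (a<d , b<d , coprime) = m%n<n (a + b) d , b<d , trans (gcd-R a b) coprime

  S-primitive : ∀ m → Primitive (S m)
  S-primitive = binary-induction (λ m → Primitive (S m))
    (subst Primitive (sym S-zero) z₀-primitive)
    (λ m p → subst Primitive (sym (S-even m)) (move-primitive true p))
    (λ m p → subst Primitive (sym (S-odd m)) (move-primitive false p))

  -- Reaching (0 , 1) from every primitive class

  infix 4 _⟶[_]_

  _⟶[_]_ : State → ℕ → State → Set
  z ⟶[ ℓ ] z′ = Σ[ w ∈ List Bool ] length w ≤ ℓ × run w z ≡ z′

  ⟶-trans : ∀ {z z′ z″ ℓ ℓ′} → z ⟶[ ℓ ] z′ → z′ ⟶[ ℓ′ ] z″ → z ⟶[ ℓ + ℓ′ ] z″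
  ⟶-trans {z} (u , |u|≤ , u-run) (w , |w|≤ , w-run) =
    u ++ w ,
    subst (_≤ _) (sym (length-++ u)) (+-mono-≤ |u|≤ |w|≤) ,
    trans (run-++ u w z) (trans (cong (run w) u-run) w-run)

  ⟶-weaken : ∀ {z z′ ℓ ℓ′} → ℓ ≤ ℓ′ → z ⟶[ ℓ ] z′ → z ⟶[ ℓ′ ] z′
  ⟶-weaken ℓ≤ℓ′ (w , |w|≤ , w-run) = w , ≤-trans |w|≤ ℓ≤ℓ′ , w-run

  L-% : ∀ x y → L (x % d , y % d) ≡ (x % d , (x + y) % d)
  L-% x y = cong (x % d ,_) (sym (%-distribˡ-+ x y d))

  R-% : ∀ x y → R (x % d , y % d) ≡ ((x + y) % d , y % d)
  R-% x y = cong (_, y % d) (sym (%-distribˡ-+ x y d))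

  Lⁿ-% : ∀ n x y → run (replicate n true) (x % d , y % d) ≡ (x % d , (n * x + y) % d)
  Lⁿ-% zero    x y = refl
  Lⁿ-% (suc n) x y = begin
    run (replicate n true) (L (x % d , y % d))    ≡⟨ cong (run (replicate n true)) (L-% x y) ⟩
    run (replicate n true) (x % d , (x + y) % d)  ≡⟨ Lⁿ-% n x (x + y) ⟩
    (x % d , (n * x + (x + y)) % d)               ≡⟨ cong (λ t → x % d , t % d) (regroup n x y) ⟩
    (x % d , (suc n * x + y) % d)                 ∎
    where
    open ≡-Reasoning
    regroup : ∀ n x y → n * x + (x + y) ≡ suc n * x + y
    regroup = solve-∀

  Rⁿ-% : ∀ n x y → run (replicate n false) (x % d , y % d) ≡ ((n * y + x) % d , y % d)
  Rⁿ-% zero    x y = refl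
  Rⁿ-% (suc n) x y = begin
    run (replicate n false) (R (x % d , y % d))    ≡⟨ cong (run (replicate n false)) (R-% x y) ⟩
    run (replicate n false) ((x + y) % d , y % d)  ≡⟨ Rⁿ-% n (x + y) y ⟩
    ((n * y + (x + y)) % d , y % d)                ≡⟨ cong (λ t → t % d , y % d) (regroup n x y) ⟩
    ((suc n * y + x) % d , y % d)                  ∎
    where
    open ≡-Reasoning
    regroup : ∀ n x y → n * y + (x + y) ≡ suc n * y + x
    regroup = solve-∀

  [[d∸1]*x+[x+k]]%d≡k%d : ∀ x k → ((d ∸ 1) * x + (x + k)) % d ≡ k % d
  [[d∸1]*x+[x+k]]%d≡k%d x k =
    trans (cong (_% d) (trans (regroup (d ∸ 1) x k) (cong (λ t → k + x * t) (suc-pred d))))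
          ([m+kn]%n≡m%n k x d)
    where
    regroup : ∀ p x k → p * x + (x + k) ≡ k + x * suc p
    regroup = solve-∀

  L-subtract : ∀ x k → (x % d , (x + k) % d) ⟶[ d ∸ 1 ] (x % d , k % d)
  L-subtract x k =
    replicate (d ∸ 1) true , ≤-reflexive (length-replicate (d ∸ 1)) ,
    trans (Lⁿ-% (d ∸ 1) x (x + k)) (cong (x % d ,_) ([[d∸1]*x+[x+k]]%d≡k%d x k))

  R-subtract : ∀ y k → ((y + k) % d , y % d) ⟶[ d ∸ 1 ] (k % d , y % d)
  R-subtract y k =
    replicate (d ∸ 1) false , ≤-reflexive (length-replicate (d ∸ 1)) ,
    trans (Rⁿ-% (d ∸ 1) (y + k) y) (cong (_, y % d) ([[d∸1]*x+[x+k]]%d≡k%d y k))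

  private
    subtract-length : ∀ n → d ∸ 1 + d * n ≤ d * suc n
    subtract-length n = ≤-trans (+-monoˡ-≤ (d * n) (m∸n≤m d 1)) (≤-reflexive (sym (*-suc d n)))

  reach-gcd : ∀ n x y → x + y ≤ n → (x % d , y % d) ⟶[ d * n ] (0 % d , gcd x y % d)
  reach-gcd n       zero      y         _ =
    [] , z≤n , cong (λ g → 0 % d , g % d) (sym (gcd-identityˡ y))
  reach-gcd (suc n) x@(suc _) zero      _ =
    ⟶-weaken (subst (_≤ d * suc n) (sym (suc-pred d)) (m≤m*n d (suc n)))
             (⟶-trans double (R-subtract x 0))
    where
    double : (x % d , 0 % d) ⟶[ 1 ] ((x + 0) % d , x % d)
    double = true ∷ [] , ≤-refl ,
             trans (L-% x 0) (cong₂ (λ u v → u % d , v % d) (sym (+-identityʳ x)) (+-identityʳ x))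
  reach-gcd (suc n) x@(suc _) y@(suc _) bound with ≤-total x y
  ... | inj₁ x≤y with m≤n⇒∃[o]m+o≡n x≤y
  ...   | k , refl = ⟶-weaken (subtract-length n) (⟶-trans (L-subtract x k)
    (subst (λ g → (x % d , k % d) ⟶[ d * n ] (0 % d , g % d)) (sym (gcd[m,m+n]≡gcd[m,n] x k))
           (reach-gcd n x k (m+n≤1+o⇒n≤o {x} z<s bound))))
  reach-gcd (suc n) x@(suc _) y@(suc _) bound | inj₂ y≤x with m≤n⇒∃[o]m+o≡n y≤x
  ...   | k , refl = ⟶-weaken (subtract-length n) (⟶-trans (R-subtract y k)
    (subst (λ g → (k % d , y % d) ⟶[ d * n ] (0 % d , g % d)) (sym (gcd[m+n,m]≡gcd[n,m] y k))
           (reach-gcd n k y (m+n≤1+o⇒n≤o {y} z<s (subst (_≤ suc n) (+-assoc y k y) bound)))))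

  K : ℕ
  K = d * (d + d) + d * (d + d)

  -- The first pass ends at (0, γ) with γ = gcd a b coprime to d; as 0 ≡ d, the second pass runs
  -- the Euclidean algorithm on (d, γ).
  reach-z₀ : ∀ {z} → Primitive z → z ⟶[ K ] z₀
  reach-z₀ {a , b} (a<d , b<d , coprime) = subst₂ _⟶[ K ]_
    (cong₂ _,_ (m<n⇒m%n≡m a<d) (m<n⇒m%n≡m b<d))
    (cong₂ _,_ 0%d≡0 (trans (cong (_% d) gcd≡1) 1%d≡1))
    (⟶-trans (reach-gcd (d + d) a b (+-mono-≤ (<⇒≤ a<d) (<⇒≤ b<d))) second-pass)
    where
    γ = gcd a b
    second-pass : (0 % d , γ % d) ⟶[ d * (d + d) ] (0 % d , gcd d (γ % d) % d)
    second-pass = subst (_⟶[ d * (d + d) ] (0 % d , gcd d (γ % d) % d))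
      (cong₂ _,_ (trans (n%n≡0 d) (sym 0%d≡0)) (m%n%n≡m%n γ d))
      (reach-gcd (d + d) d (γ % d) (+-monoʳ-≤ d (<⇒≤ (m%n<n γ d))))
    gcd≡1 : gcd d (γ % d) ≡ 1
    gcd≡1 = trans (gcd[n,m%n]≡gcd[m,n] γ d) coprime

  Lⁿ-z₀ : ∀ n → run (replicate n true) z₀ ≡ z₀
  Lⁿ-z₀ zero    = refl
  Lⁿ-z₀ (suc n) = trans (cong (run (replicate n true)) L-z₀) (Lⁿ-z₀ n)

  synchronizing-word : ∀ {z} → Primitive z → Σ[ w ∈ List Bool ] length w ≡ K × run w z ≡ z₀
  synchronizing-word {z} pz with reach-z₀ pz
  ... | w , |w|≤K , w-run =
    w ++ padding ,
    trans (length-++ w)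
          (trans (cong (length w +_) (length-replicate (K ∸ length w))) (m+[n∸m]≡n |w|≤K)) ,
    trans (run-++ w padding z) (trans (cong (run padding) w-run) (Lⁿ-z₀ (K ∸ length w)))
    where
    padding : List Bool
    padding = replicate (K ∸ length w) true

  -- The transfer operator

  P : (State → ℕ) → State → ℕ
  P h z = h (L z) + h (R z)

  Pⁿ : ℕ → (State → ℕ) → State → ℕ
  Pⁿ zero    h = h
  Pⁿ (suc n) h = P (Pⁿ n h)

  P-split : ∀ b h z → P h z ≡ h (move b z) + h (move (not b) z)
  P-split true  h z = refl
  P-split false h z = +-comm (h (L z)) (h (R z))

  Pⁿ-mono-≤ : ∀ {f g : State → ℕ} → (∀ z → Primitive z → f z ≤ g z) →
              ∀ n z → Primitive z → Pⁿ n f z ≤ Pⁿ n g z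
  Pⁿ-mono-≤ f≤g zero    z pz = f≤g z pz
  Pⁿ-mono-≤ f≤g (suc n) z pz = +-mono-≤ (Pⁿ-mono-≤ f≤g n (L z) (move-primitive true pz))
                                         (Pⁿ-mono-≤ f≤g n (R z) (move-primitive false pz))

  Pⁿ-const : ∀ c n z → Pⁿ n (λ _ → c) z ≡ 2 ^ n * c
  Pⁿ-const c zero    z = sym (+-identityʳ c)
  Pⁿ-const c (suc n) z =
    trans (cong₂ _+_ (Pⁿ-const c n (L z)) (Pⁿ-const c n (R z))) (sym ([2*m]*n≡m*n+m*n (2 ^ n) c))

  -- Pⁿ h z sums h over the endpoints of all 2ⁿ words of length n read from z: keep the endpoint
  -- of w and bound the 2ⁿ - 1 others by the band of h.
  Pⁿ-lower : ∀ {h c} → (∀ z → Primitive z → c ≤ h z) → ∀ w z → Primitive z →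
             h (run w z) + 2 ^ length w * c ≤ Pⁿ (length w) h z + c
  Pⁿ-lower {h} {c} c≤h []      z pz = ≤-reflexive (cong (h z +_) (+-identityʳ c))
  Pⁿ-lower {h} {c} c≤h (b ∷ w) z pz = begin
    h (run w z′) + 2 ^ suc n * c            ≡⟨ cong (h (run w z′) +_) ([2*m]*n≡m*n+m*n (2 ^ n) c) ⟩
    h (run w z′) + (2 ^ n * c + 2 ^ n * c)  ≡⟨ +-assoc (h (run w z′)) _ _ ⟨
    h (run w z′) + 2 ^ n * c + 2 ^ n * c    ≤⟨ +-mono-≤ (Pⁿ-lower c≤h w z′ pz′) sibling ⟩
    Pⁿ n h z′ + c + Pⁿ n h z″               ≡⟨ xy∙z≈xz∙y (Pⁿ n h z′) c (Pⁿ n h z″) ⟩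
    Pⁿ n h z′ + Pⁿ n h z″ + c               ≡⟨ cong (_+ c) (P-split b (Pⁿ n h) z) ⟨
    Pⁿ (suc n) h z + c                      ∎
    where
    open ≤-Reasoning
    n  = length w
    z′ = move b z
    z″ = move (not b) z
    pz′ = move-primitive b pz
    sibling : 2 ^ n * c ≤ Pⁿ n h z″
    sibling = subst (_≤ Pⁿ n h z″) (Pⁿ-const c n z″)
                    (Pⁿ-mono-≤ {f = λ _ → c} c≤h n z″ (move-primitive (not b) pz))

  Pⁿ-upper : ∀ {h u} → (∀ z → Primitive z → h z ≤ u) → ∀ w z → Primitive z →
             Pⁿ (length w) h z + u ≤ h (run w z) + 2 ^ length w * u
  Pⁿ-upper {h} {u} h≤u []      z pz = ≤-reflexive (cong (h z +_) (sym (+-identityʳ u)))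
  Pⁿ-upper {h} {u} h≤u (b ∷ w) z pz = begin
    Pⁿ (suc n) h z + u                      ≡⟨ cong (_+ u) (P-split b (Pⁿ n h) z) ⟩
    Pⁿ n h z′ + Pⁿ n h z″ + u               ≡⟨ xy∙z≈xz∙y (Pⁿ n h z′) (Pⁿ n h z″) u ⟩
    Pⁿ n h z′ + u + Pⁿ n h z″               ≤⟨ +-mono-≤ (Pⁿ-upper h≤u w z′ pz′) sibling ⟩
    h (run w z′) + 2 ^ n * u + 2 ^ n * u    ≡⟨ +-assoc (h (run w z′)) _ _ ⟩
    h (run w z′) + (2 ^ n * u + 2 ^ n * u)  ≡⟨ cong (h (run w z′) +_) ([2*m]*n≡m*n+m*n (2 ^ n) u) ⟨
    h (run w z′) + 2 ^ suc n * u            ∎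
    where
    open ≤-Reasoning
    n  = length w
    z′ = move b z
    z″ = move (not b) z
    pz′ = move-primitive b pz
    sibling : Pⁿ n h z″ ≤ 2 ^ n * u
    sibling = subst (Pⁿ n h z″ ≤_) (Pⁿ-const u n z″)
                    (Pⁿ-mono-≤ {g = λ _ → u} h≤u n z″ (move-primitive (not b) pz))

  Oscillation≤ : (State → ℕ) → ℕ → Set
  Oscillation≤ h D = Σ[ c ∈ ℕ ] (∀ z → Primitive z → c ≤ h z × h z ≤ c + D)

  contraction : ∀ ℓ → (∀ {z} → Primitive z → Σ[ w ∈ List Bool ] length w ≡ ℓ × run w z ≡ z₀) →
                ∀ {h D} → Oscillation≤ h D → Oscillation≤ (Pⁿ ℓ h) (pred (2 ^ ℓ) * D)
  contraction ℓ sync {h} {D} (c , band) = h z₀ + r * c , bounds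
    where
    r = pred (2 ^ ℓ)
    2^ℓ≡1+r : 2 ^ ℓ ≡ suc r
    2^ℓ≡1+r = sym (suc-pred (2 ^ ℓ) {{m^n≢0 2 ℓ}})
    bounds : ∀ z → Primitive z → h z₀ + r * c ≤ Pⁿ ℓ h z × Pⁿ ℓ h z ≤ h z₀ + r * c + r * D
    bounds z pz with sync pz
    ... | w , refl , w-run = lower , upper
      where
      open ≤-Reasoning
      lower : h z₀ + r * c ≤ Pⁿ (length w) h z
      lower = +-cancelʳ-≤ c _ _ (begin
        h z₀ + r * c + c                 ≡⟨ regroup (h z₀) r c ⟩
        h z₀ + suc r * c                 ≡⟨ cong₂ (λ t s → h t + s * c) (sym w-run) (sym 2^ℓ≡1+r) ⟩
        h (run w z) + 2 ^ length w * c   ≤⟨ Pⁿ-lower (λ z pz → proj₁ (band z pz)) w z pz ⟩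
        Pⁿ (length w) h z + c            ∎)
        where
        regroup : ∀ x s c → x + s * c + c ≡ x + suc s * c
        regroup = solve-∀
      upper : Pⁿ (length w) h z ≤ h z₀ + r * c + r * D
      upper = +-cancelʳ-≤ (c + D) _ _ (begin
        Pⁿ (length w) h z + (c + D)           ≤⟨ Pⁿ-upper (λ z pz → proj₂ (band z pz)) w z pz ⟩
        h (run w z) + 2 ^ length w * (c + D)  ≡⟨ cong₂ (λ t s → h t + s * (c + D)) w-run 2^ℓ≡1+r ⟩
        h z₀ + suc r * (c + D)                ≡⟨ regroup (h z₀) r c D ⟩
        h z₀ + r * c + r * D + (c + D)        ∎)
        where
        regroup : ∀ x s c D → x + suc s * (c + D) ≡ x + s * c + s * D + (c + D)
        regroup = solve-∀

  -- Sums over primitive classes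

  isPrimitive : State → Bool
  isPrimitive (a , b) = ⌊ gcd (gcd a b) d ≟ 1 ⌋

  isPrimitive-L : ∀ z → isPrimitive (L z) ≡ isPrimitive z
  isPrimitive-L (a , b) = cong (λ g → ⌊ g ≟ 1 ⌋) (gcd-L a b)

  isPrimitive-R : ∀ z → isPrimitive (R z) ≡ isPrimitive z
  isPrimitive-R (a , b) = cong (λ g → ⌊ g ≟ 1 ⌋) (gcd-R a b)

  restrict : (State → ℕ) → State → ℕ
  restrict h z = if isPrimitive z then h z else 0

  ∑ₚ : (State → ℕ) → ℕ
  ∑ₚ h = ∑[ a < d ] ∑[ b < d ] restrict h (a , b)

  restrict-∘ : ∀ (s : State → State) → (∀ z → isPrimitive (s z) ≡ isPrimitive z) →
               ∀ h z → restrict (λ z → h (s z)) z ≡ restrict h (s z)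
  restrict-∘ s invariant h z rewrite invariant z = refl

  restrict-+ : ∀ h h′ z → restrict (λ z → h z + h′ z) z ≡ restrict h z + restrict h′ z
  restrict-+ h h′ z with isPrimitive z
  ... | true  = refl
  ... | false = refl

  restrict-const : ∀ c z → restrict (λ _ → c) z ≡ c * restrict (λ _ → 1) z
  restrict-const c z with isPrimitive z
  ... | true  = sym (*-identityʳ c)
  ... | false = sym (*-zeroʳ c)

  ∑ₚ-∘L : ∀ h → ∑ₚ (λ z → h (L z)) ≡ ∑ₚ h
  ∑ₚ-∘L h = ∑-cong d (λ a _ →
    trans (∑-cong d (λ b _ → restrict-∘ L isPrimitive-L h (a , b)))
          (∑-rotate d (λ b → restrict h (a , b)) a))

  ∑ₚ-∘R : ∀ h → ∑ₚ (λ z → h (R z)) ≡ ∑ₚ h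
  ∑ₚ-∘R h = begin
    ∑ₚ (λ z → h (R z))                                  ≡⟨ ∑-cong d (λ a _ → ∑-cong d (λ b _ → moved a b)) ⟩
    ∑[ a < d ] ∑[ b < d ] restrict h ((a + b) % d , b)  ≡⟨ ∑-comm (λ a b → restrict h ((a + b) % d , b)) d d ⟩
    ∑[ b < d ] ∑[ a < d ] restrict h ((a + b) % d , b)  ≡⟨ ∑-cong d (λ b _ → rotate b) ⟩
    ∑[ b < d ] ∑[ a < d ] restrict h (a , b)            ≡⟨ ∑-comm (λ a b → restrict h (a , b)) d d ⟨
    ∑ₚ h                                                ∎
    where
    open ≡-Reasoning
    moved : ∀ a b → restrict (λ z → h (R z)) (a , b) ≡ restrict h ((a + b) % d , b)
    moved a b = restrict-∘ R isPrimitive-R h (a , b)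
    rotate : ∀ b → ∑[ a < d ] restrict h ((a + b) % d , b) ≡ ∑[ a < d ] restrict h (a , b)
    rotate b = trans (∑-cong d (λ a _ → cong (λ t → restrict h (t % d , b)) (+-comm a b)))
                     (∑-rotate d (λ a → restrict h (a , b)) b)

  ∑ₚ-distrib-+ : ∀ h h′ → ∑ₚ (λ z → h z + h′ z) ≡ ∑ₚ h + ∑ₚ h′
  ∑ₚ-distrib-+ h h′ = trans
    (∑-cong d (λ a _ → trans (∑-cong d (λ b _ → restrict-+ h h′ (a , b))) (∑-distrib-+ d)))
    (∑-distrib-+ d)

  ∑ₚ-P : ∀ h → ∑ₚ (P h) ≡ 2 * ∑ₚ h
  ∑ₚ-P h = begin
    ∑ₚ (P h)                            ≡⟨ ∑ₚ-distrib-+ (λ z → h (L z)) (λ z → h (R z)) ⟩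
    ∑ₚ (λ z → h (L z)) + ∑ₚ (λ z → h (R z))  ≡⟨ cong₂ _+_ (∑ₚ-∘L h) (∑ₚ-∘R h) ⟩
    ∑ₚ h + ∑ₚ h                         ≡⟨ cong (∑ₚ h +_) (+-identityʳ (∑ₚ h)) ⟨
    2 * ∑ₚ h                            ∎
    where open ≡-Reasoning

  ∑ₚ-Pⁿ : ∀ n h → ∑ₚ (Pⁿ n h) ≡ 2 ^ n * ∑ₚ h
  ∑ₚ-Pⁿ zero    h = sym (+-identityʳ (∑ₚ h))
  ∑ₚ-Pⁿ (suc n) h =
    trans (∑ₚ-P (Pⁿ n h)) (trans (cong (2 *_) (∑ₚ-Pⁿ n h)) (sym (*-assoc 2 (2 ^ n) (∑ₚ h))))

  ∑ₚ-mono-≤ : ∀ {h h′} → (∀ z → Primitive z → h z ≤ h′ z) → ∑ₚ h ≤ ∑ₚ h′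
  ∑ₚ-mono-≤ {h} {h′} h≤h′ = ∑-mono-≤ d (λ a a<d → ∑-mono-≤ d (λ b b<d → restricted a b a<d b<d))
    where
    restricted : ∀ a b → a < d → b < d → restrict h (a , b) ≤ restrict h′ (a , b)
    restricted a b a<d b<d with gcd (gcd a b) d ≟ 1
    ... | yes coprime = h≤h′ (a , b) (a<d , b<d , coprime)
    ... | no  _       = z≤n

  ∑ₚ-const : ∀ c → ∑ₚ (λ _ → c) ≡ c * Nd d
  ∑ₚ-const c = begin
    ∑ₚ (λ _ → c)                         ≡⟨ ∑-cong d (λ a _ → row a) ⟩
    ∑[ a < d ] (c * count a)             ≡⟨ ∑-distribˡ-* c d ⟩
    c * ∑ₚ (λ _ → 1)                     ≡⟨ cong (c *_) (trans (Nd-∑ d) (∑-cong d (λ a _ → countBelow-∑ _ d))) ⟨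
    c * Nd d                             ∎
    where
    open ≡-Reasoning
    count : ℕ → ℕ
    count a = ∑[ b < d ] restrict (λ _ → 1) (a , b)
    row : ∀ a → ∑[ b < d ] restrict (λ _ → c) (a , b) ≡ c * count a
    row a = trans (∑-cong d (λ b _ → restrict-const c (a , b))) (∑-distribˡ-* c d)

  𝟙 : ℕ → ℕ → State → ℕ
  𝟙 a b (x , y) = if ⌊ x ≟ a ⌋ ∧ ⌊ y ≟ b ⌋ then 1 else 0

  ∑ₚ-𝟙 : ∀ {a b} → Primitive (a , b) → ∑ₚ (𝟙 a b) ≡ 1
  ∑ₚ-𝟙 {a} {b} (a<d , b<d , coprime) =
    trans (∑-pointed a d a<d (λ x _ x≢a → ∑-zero d (λ y _ → off-row x y x≢a)))
          (trans (∑-pointed b d b<d (λ y _ y≢b → off-column y y≢b)) at-point)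
    where
    restrict-zero : ∀ z → restrict (λ _ → 0) z ≡ 0
    restrict-zero z with isPrimitive z
    ... | true  = refl
    ... | false = refl
    off-row : ∀ x y → x ≢ a → restrict (𝟙 a b) (x , y) ≡ 0
    off-row x y x≢a with x ≟ a
    ... | yes x≡a = contradiction x≡a x≢a
    ... | no  _   = restrict-zero (x , y)
    off-column : ∀ y → y ≢ b → restrict (𝟙 a b) (a , y) ≡ 0
    off-column y y≢b with a ≟ a | y ≟ b
    ... | _     | yes y≡b = contradiction y≡b y≢b
    ... | yes _ | no _    = restrict-zero (a , y)
    ... | no  _ | no _    = restrict-zero (a , y)
    at-point : restrict (𝟙 a b) (a , b) ≡ 1
    at-point with gcd (gcd a b) d ≟ 1 | a ≟ a | b ≟ b
    ... | yes _       | yes _   | yes _   = refl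
    ... | no ¬coprime | _       | _       = contradiction coprime ¬coprime
    ... | yes _       | no a≢a  | _       = contradiction refl a≢a
    ... | yes _       | yes _   | no b≢b  = contradiction refl b≢b

  -- Equidistribution along the Stern sequence

  𝟙-oscillation : ∀ a b → Oscillation≤ (𝟙 a b) 1
  𝟙-oscillation a b = 0 , λ z _ → z≤n , at-most-one z
    where
    at-most-one : ∀ z → 𝟙 a b z ≤ 1
    at-most-one (x , y) with ⌊ x ≟ a ⌋ ∧ ⌊ y ≟ b ⌋
    ... | true  = ≤-refl
    ... | false = z≤n

  orbitSum : (State → ℕ) → ℕ → ℕ
  orbitSum h N = ∑[ m < N ] h (S m)

  orbitSum-double : ∀ h M → orbitSum h (M + M) ≡ orbitSum (P h) M
  orbitSum-double h M =
    trans (∑-pairs M) (∑-cong M (λ m _ → cong₂ _+_ (cong h (S-even m)) (cong h (S-odd m))))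

  orbitSum-2^ : ∀ n h M → orbitSum h (2 ^ n * M) ≡ orbitSum (Pⁿ n h) M
  orbitSum-2^ zero    h M = cong (orbitSum h) (+-identityʳ M)
  orbitSum-2^ (suc n) h M = begin
    orbitSum h (2 ^ suc n * M)     ≡⟨ cong (orbitSum h) (regroup (2 ^ n) M) ⟩
    orbitSum h (2 ^ n * (M + M))   ≡⟨ orbitSum-2^ n h (M + M) ⟩
    orbitSum (Pⁿ n h) (M + M)      ≡⟨ orbitSum-double (Pⁿ n h) M ⟩
    orbitSum (Pⁿ (suc n) h) M      ∎
    where
    open ≡-Reasoning
    regroup : ∀ x M → 2 * x * M ≡ x * (M + M)
    regroup = solve-∀

  B≡orbitSum-𝟙 : ∀ a b N → B d a b N ≡ orbitSum (𝟙 a b) N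
  B≡orbitSum-𝟙 a b N = countBelow-∑ _ N

  Q ρ : ℕ
  Q = 2 ^ K
  ρ = pred Q

  instance
    Q-nonZero : NonZero Q
    Q-nonZero = m^n≢0 2 K

  Pᴷ-contracts : ∀ {h D} → Oscillation≤ h D → Oscillation≤ (Pⁿ K h) (ρ * D)
  Pᴷ-contracts = contraction K synchronizing-word

  ≈-average : ∀ {h D} → Oscillation≤ h D → ∀ {z} → Primitive z → Nd d * h z ≈[ Nd d * D ] ∑ₚ h
  ≈-average {h} {D} (c , band) {z} pz = ≈-interval
    (*-monoʳ-≤ (Nd d) (proj₁ (band z pz)))
    (subst (Nd d * h z ≤_) (*-distribˡ-+ (Nd d) c D) (*-monoʳ-≤ (Nd d) (proj₂ (band z pz))))
    (subst (_≤ ∑ₚ h) (trans (∑ₚ-const c) (*-comm c (Nd d))) (∑ₚ-mono-≤ (λ z pz → proj₁ (band z pz))))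
    (subst (∑ₚ h ≤_) (trans (∑ₚ-const (c + D)) (Nd-scaled c D)) (∑ₚ-mono-≤ (λ z pz → proj₂ (band z pz))))
    where
    Nd-scaled : ∀ c D → (c + D) * Nd d ≡ Nd d * c + Nd d * D
    Nd-scaled c D = trans (*-comm (c + D) (Nd d)) (*-distribˡ-+ (Nd d) c D)

  -- With N = Q M + r, the first Q M terms form the orbit sum of Pᴷ h up to M, and each of the
  -- last r terms lies within the oscillation of the mean.
  equidistribution : ∀ {h D} → Oscillation≤ h D → ∀ l N → N < Q ^ l →
                     Nd d * orbitSum h N ≈[ Nd d * Q * D * geom ρ l ] ∑ₚ h * N
  equidistribution {h} osc zero    zero    _ =
    ≈-reflexive (trans (*-zeroʳ (Nd d)) (sym (*-zeroʳ (∑ₚ h))))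
  equidistribution     osc zero    (suc N) (s≤s ())
  equidistribution {h} {D} osc (suc l) N N<Q^1+l =
    ≈-weaken error≤ (subst₂ _≈[ error ]_ lhs rhs (≈-+ coarse fine))
    where
    M r error : ℕ
    M = N / Q
    r = N % Q
    error = Nd d * Q * (ρ * D) * geom ρ l + r * (Nd d * D)
    N≡QM+r : N ≡ Q * M + r
    N≡QM+r = trans (m≡m%n+[m/n]*n N Q) (trans (+-comm r (M * Q)) (cong (_+ r) (*-comm M Q)))
    coarse : Nd d * orbitSum (Pⁿ K h) M ≈[ Nd d * Q * (ρ * D) * geom ρ l ] ∑ₚ (Pⁿ K h) * M
    coarse = equidistribution (Pᴷ-contracts osc) l M
               (m<n*o⇒m/o<n (subst (N <_) (*-comm Q (Q ^ l)) N<Q^1+l))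
    fine : ∑[ i < r ] (Nd d * h (S (Q * M + i))) ≈[ r * (Nd d * D) ] ∑[ i < r ] ∑ₚ h
    fine = ≈-∑ r (λ i _ → ≈-average osc (S-primitive (Q * M + i)))
    lhs : Nd d * orbitSum (Pⁿ K h) M + ∑[ i < r ] (Nd d * h (S (Q * M + i))) ≡ Nd d * orbitSum h N
    lhs = begin
      Nd d * orbitSum (Pⁿ K h) M + ∑[ i < r ] (Nd d * h (S (Q * M + i)))
        ≡⟨ cong₂ _+_ (cong (Nd d *_) (sym (orbitSum-2^ K h M))) (∑-distribˡ-* (Nd d) r) ⟩
      Nd d * orbitSum h (Q * M) + Nd d * ∑[ i < r ] h (S (Q * M + i))
        ≡⟨ *-distribˡ-+ (Nd d) _ _ ⟨
      Nd d * (orbitSum h (Q * M) + ∑[ i < r ] h (S (Q * M + i)))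
        ≡⟨ cong (Nd d *_) (∑-split (Q * M) r) ⟨
      Nd d * orbitSum h (Q * M + r)
        ≡⟨ cong (λ n → Nd d * orbitSum h n) N≡QM+r ⟨
      Nd d * orbitSum h N ∎
      where open ≡-Reasoning
    rhs : ∑ₚ (Pⁿ K h) * M + ∑[ i < r ] ∑ₚ h ≡ ∑ₚ h * N
    rhs = begin
      ∑ₚ (Pⁿ K h) * M + ∑[ i < r ] ∑ₚ h  ≡⟨ cong₂ _+_ (cong (_* M) (∑ₚ-Pⁿ K h)) (∑-const (∑ₚ h) r) ⟩
      Q * ∑ₚ h * M + r * ∑ₚ h            ≡⟨ regroup Q (∑ₚ h) M r ⟩
      ∑ₚ h * (Q * M + r)                 ≡⟨ cong (∑ₚ h *_) N≡QM+r ⟨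
      ∑ₚ h * N                           ∎
      where
      open ≡-Reasoning
      regroup : ∀ Q s M r → Q * s * M + r * s ≡ s * (Q * M + r)
      regroup = solve-∀
    error≤ : error ≤ Nd d * Q * D * geom ρ (suc l)
    error≤ = ≤-trans (+-monoʳ-≤ (Nd d * Q * (ρ * D) * geom ρ l) (*-monoˡ-≤ (Nd d * D) (<⇒≤ (m%n<n N Q))))
                     (≤-reflexive (regroup (Nd d) Q ρ D (geom ρ l)))
      where
      regroup : ∀ n Q ρ D g → n * Q * (ρ * D) * g + Q * (n * D) ≡ n * Q * D * (1 + ρ * g)
      regroup = solve-∀

  p q : ℕ
  p = ρ * ρ
  q = suc p

  ρ^q≤Q^p : ρ ^ q ≤ Q ^ p
  ρ^q≤Q^p = subst (λ t → ρ ^ q ≤ t ^ p) (suc-pred Q) (m^[1+m*m]≤[1+m]^[m*m] ρ)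

  2≤ρ : 2 ≤ ρ
  2≤ρ = ≤-trans (n≤1+n 2) (pred-mono-≤ (^-monoʳ-≤ 2 2≤K))
    where
    2≤K : 2 ≤ K
    2≤K = ≤-trans 2≤d (≤-trans (m≤m+n d d) (≤-trans (m≤n*m (d + d) d) (m≤m+n _ _)))

  discrepancy : ∀ {a b} → Primitive (a , b) → ∀ N → 1 ≤ N →
                ∣ Nd d * B d a b N - N ∣ ^ q ≤ (Nd d * Q) ^ q * Q ^ p * N ^ p
  discrepancy {a} {b} pab N@(suc N′) _ with log-bracket {Q} (≤-trans 2≤ρ pred[n]≤n) N′
  ... | l , Q^l≤N , N<Q^1+l =
    ≤-trans (^-monoˡ-≤ q error≤) (geometric⇒power {Nd d * Q} {ρ} {Q} {p} {q} {l} ρ^q≤Q^p Q^l≤N)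
    where
    close : Nd d * B d a b N ≈[ Nd d * Q * 1 * geom ρ (suc l) ] N
    close = subst₂ _≈[ Nd d * Q * 1 * geom ρ (suc l) ]_
      (cong (Nd d *_) (sym (B≡orbitSum-𝟙 a b N)))
      (trans (cong (_* N) (∑ₚ-𝟙 pab)) (*-identityˡ N))
      (equidistribution (𝟙-oscillation a b) (suc l) N N<Q^1+l)
    error≤ : ∣ Nd d * B d a b N - N ∣ ≤ Nd d * Q * ρ ^ suc l
    error≤ = ≤-trans (≈⇒∣-∣≤ close)
      (≤-trans (≤-reflexive (cong (_* geom ρ (suc l)) (*-identityʳ (Nd d * Q))))
               (*-monoʳ-≤ (Nd d * Q) (<⇒≤ (geom<^ 2≤ρ (suc l)))))

theorem4p7 : (d : ℕ) → .{{_ : NonZero d}} → 2 ≤ d →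
    Σ ℕ λ p → Σ ℕ λ q → p < q ×
      ((a b : ℕ) → a < d → b < d → gcd (gcd a b) d ≡ 1 →
        Σ ℕ λ C → Σ ℕ λ N0 → (N : ℕ) → N0 ≤ N →
          ∣ Nd d * B d a b N - N ∣ ^ q ≤ C * N ^ p)
theorem4p7 d 2≤d = p , q , ≤-refl , λ a b a<d b<d coprime →
  (Nd d * Q) ^ q * Q ^ p , 1 , discrepancy (a<d , b<d , coprime)
  where open Residues d 2≤d
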